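{- Let $q=p^s$ be a power of a prime $p$ with $q\neq2$, and for each integer $d\ge1$ let $\pi_q(d)$ be the number of monic irreducible polynomials of degree $d$ in $\mathbb{F}_q[x]$, i.e. $\pi_q(d)=\frac1d\sum_{j\mid d}\mu(j)q^{d/j}$ with $\mu$ the Möbius function. Then for every integer $d\ge1$, either $p\mid\pi_q(d)$ or $4\mid\pi_q(d)$. -}

module Defs where

open import Data.Bool using (if_then_else_)
open import Data.Nat as ℕ using (ℕ; zero; suc)
open import Data.Nat.Divisibility using (_∣?_)
open import Data.Nat.Primality using (prime?)
open import Data.List using (List; filter; length; upTo; map; null; foldr)
open import Data.Integer as ℤ using (ℤ; +_; -1ℤ; 0ℤ)
open import Data.Integer.DivMod using (_/ℕ_)
open import Relation.Nullary.Decidable using (does)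

divisors : ℕ → List ℕ
divisors n = filter (λ k → k ∣? n) (map suc (upTo n))

primeDivisors : ℕ → List ℕ
primeDivisors n = filter prime? (divisors n)

μ : ℕ → ℤ
μ n = if null (filter (λ p → (p ℕ.* p) ∣? n) (primeDivisors n))
      then -1ℤ ℤ.^ length (primeDivisors n)
      else 0ℤ

necklaceSum : ℕ → ℕ → ℤ
necklaceSum q d = foldr ℤ._+_ 0ℤ (map term (upTo d))
  where
  term : ℕ → ℤ
  term k = if does (suc k ∣? d) then μ (suc k) ℤ.* (+ (q ℕ.^ (d ℕ./ suc k))) else 0ℤ

-- π_q(d) = (1/d) Σ_{j ∣ d} μ(j) q^(d/j)   (d ≥ 1; value at d = 0 is irrelevant)
πq : ℕ → ℕ → ℤ
πq q zero = 0ℤ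
πq q d@(suc _) = necklaceSum q d /ℕ d

module Submission where

-- Write N_x(n) = Σ_{j ∣ n} μ(j) x^(n/j), so that π_q(d) = N_q(d) / d.  For a prime ℓ ∤ m only the
-- divisors i and ℓ i (i ∣ m) of ℓ^(a+1) m carry a nonzero Möbius value, with μ(ℓ i) = -μ(i); hence
-- N_x(ℓ^(a+1) m) = N_{x^(ℓ^(a+1))}(m) - N_{x^(ℓ^a)}(m), a Möbius sum of the differences
-- x^(ℓ^(a+1) c) - x^(ℓ^a c).  Fermat's little theorem, lifted to x^(ℓ^(b+1)) ≡ x^(ℓ^b) (mod ℓ^(b+1)),
-- and induction on n give n ∣ N_x(n), so π_q(d) is an exact quotient t with N_q(d) = t d.
--
-- If p ∤ d, then p ∣ q ∣ N_q(d) = t d forces p ∣ t.  If p = 2, then q = 2^s with s ≥ 2; writing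
-- d = 2^(a+1) m with m odd, every difference above is divisible by q^(2^a), hence by 2^(a+2), so t is
-- even.  If p is odd and p ∣ d = 2^a m with m odd, then m ≥ 3, so Σ_{i ∣ m} μ(i) = 0 and a constant
-- may be subtracted from each term; the resulting differences x^(2^k c) - x^(2^k) (x, c odd) are
-- divisible by 2^(k+3), which gives 2^(a+2) ∣ N_q(d) and 4 ∣ t.

open import Defs

module Necklaces where

  open import Data.Bool using (Bool; true; false; if_then_else_; _∧_)
  open import Data.Bool.Properties using (∧-zeroʳ)
  open import Data.Empty using (⊥-elim)
  open import Data.Integer using (ℤ; +_; -[1+_]; 0ℤ; 1ℤ; -1ℤ; _+_; _-_; _*_; -_; _^_; ∣_∣)
  import Data.Integer.Properties as ℤ
  open import Data.Integer.DivMod using (_%ℕ_; _/ℕ_; a≡a%ℕn+[a/ℕn]*n)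
  open import Data.Integer.Divisibility.Signed as ℤ∣ using (divides) renaming (_∣_ to _∣ℤ_)
  open import Data.Integer.Tactic.RingSolver using (solve-∀)
  open import Data.List using (List; []; _∷_; filter; length; map; null; foldr; upTo; applyUpTo)
  open import Data.List.Membership.Propositional using (_∈_)
  open import Data.List.Membership.Propositional.Properties using (∈-map⁺; ∈-upTo⁺; ∈-filter⁺; ∈-filter⁻)
  open import Data.List.Properties using (map-∘; map-cong; map-upTo; filter-none)
  open import Data.List.Relation.Unary.All as All using (All; _∷_)
  open import Data.List.Relation.Unary.All.Properties using (all-filter)
  open import Data.List.Relation.Unary.Any using (here; there)
  open import Data.Nat as ℕ using (ℕ; zero; suc; _≤_; _<_; z≤n; s≤s; NonZero; NonTrivial; _!)
  import Data.Nat.Properties as ℕ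
  open import Data.Nat.Combinatorics
    using (_C_; nCk≡n!/k![n-k]!; k![n∸k]!∣n!; k>n⇒nCk≡0; nCn≡1; nCk+nC[k+1]≡[n+1]C[k+1])
  open import Data.Nat.Coprimality using (Coprime; coprime-divisor)
  open import Data.Nat.Divisibility
    using (_∣_; _∣?_; divides; ∣⇒≤; ∣1⇒≡1; 0∣⇒≡0; 1∣_; _∣0; ∣-trans; ∣m+n∣m⇒∣n; m∣m*n; n∣m*n; ∣m⇒∣m*n; ∣n⇒∣m*n;
           *-monoʳ-∣; *-monoˡ-∣; *-cancelˡ-∣; *-cancelʳ-∣; m/n∣m)
  open import Data.Nat.DivMod
    using (m*n/n≡m; m/n*n≡m; m*n%n≡0; *-/-assoc; m*n/o*n≡m/o; 0/n≡0; /-congˡ; m≡m%n+[m/n]*n; m%n<n)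
  open import Data.Nat.Induction using (<-wellFounded)
  open import Data.Nat.Primality
    using (Prime; prime?; euclidsLemma; prime⇒irreducible; prime⇒nonZero; prime⇒nonTrivial; prime[2])
  open import Data.Nat.Primality.Factorisation using (factorise)
  open import Data.Product using (∃-syntax; ∃₂; _×_; _,_; proj₂)
  open import Data.Sum using (_⊎_; inj₁; inj₂; [_,_]′; reduce)
  open import Function using (id; _∘_; case_of_)
  open import Induction.WellFounded using (Acc; acc)
  open import Relation.Nullary using (¬_; yes; no)
  open import Relation.Nullary.Decidable using (does; dec-true; dec-false)
  open import Relation.Binary.PropositionalEquality
  open import Algebra.Properties.CommutativeSemigroup ℕ.*-commutativeSemigroup
    using (x∙yz≈y∙xz; x∙yz≈y∙zx; x∙yz≈z∙xy)
  open import Algebra.Properties.CommutativeSemigroup ℤ.+-commutativeSemigroup using (interchange)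
  open import Algebra.Properties.Ring ℤ.+-*-ring using (x[y-z]≈xy-xz)

  -- Finite sums

  -- ∑ n f = f 1 + ⋯ + f n (the index 0 is never summed).
  ∑ : ℕ → (ℕ → ℤ) → ℤ
  ∑ zero    f = 0ℤ
  ∑ (suc n) f = ∑ n f + f (suc n)

  𝟙 : Bool → ℤ
  𝟙 true  = 1ℤ
  𝟙 false = 0ℤ

  ∑-cong : ∀ n {f g : ℕ → ℤ} → (∀ j → f j ≡ g j) → ∑ n f ≡ ∑ n g
  ∑-cong zero    f≗g = refl
  ∑-cong (suc n) f≗g = cong₂ _+_ (∑-cong n f≗g) (f≗g (suc n))

  ∑-zero : ∀ n {f : ℕ → ℤ} → (∀ {j} → 1 ≤ j → j ≤ n → f j ≡ 0ℤ) → ∑ n f ≡ 0ℤ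
  ∑-zero zero    f≡0 = refl
  ∑-zero (suc n) f≡0 =
    cong₂ _+_ (∑-zero n (λ 1≤j j≤n → f≡0 1≤j (ℕ.m≤n⇒m≤1+n j≤n))) (f≡0 (s≤s z≤n) ℕ.≤-refl)

  ∑-+ : ∀ n (f g : ℕ → ℤ) → ∑ n (λ j → f j + g j) ≡ ∑ n f + ∑ n g
  ∑-+ zero    f g = refl
  ∑-+ (suc n) f g =
    trans (cong (_+ (f (suc n) + g (suc n))) (∑-+ n f g)) (interchange (∑ n f) (∑ n g) _ _)

  ∑-neg : ∀ n (f : ℕ → ℤ) → ∑ n (λ j → - f j) ≡ - ∑ n f
  ∑-neg zero    f = refl
  ∑-neg (suc n) f = trans (cong (_+ - f (suc n)) (∑-neg n f)) (sym (ℤ.neg-distrib-+ (∑ n f) _))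

  ∑-- : ∀ n (f g : ℕ → ℤ) → ∑ n (λ j → f j - g j) ≡ ∑ n f - ∑ n g
  ∑-- n f g = trans (∑-+ n f (λ j → - g j)) (cong (λ s → ∑ n f + s) (∑-neg n g))

  ∑-∣ : ∀ n {k} {f : ℕ → ℤ} → (∀ j → k ∣ℤ f j) → k ∣ℤ ∑ n f
  ∑-∣ zero    k∣f = divides 0ℤ refl
  ∑-∣ (suc n) k∣f = ℤ∣.∣m∣n⇒∣m+n (∑-∣ n k∣f) (k∣f (suc n))

  ∑-unshift : ∀ n (f : ℕ → ℤ) → ∑ (suc n) f ≡ f 1 + ∑ n (f ∘ suc)
  ∑-unshift zero    f = trans (ℤ.+-identityˡ (f 1)) (sym (ℤ.+-identityʳ (f 1)))
  ∑-unshift (suc n) f = trans (cong (_+ f (suc (suc n))) (∑-unshift n f)) (ℤ.+-assoc (f 1) _ _)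

  ∑-++ : ∀ m n (f : ℕ → ℤ) → ∑ (m ℕ.+ n) f ≡ ∑ m f + ∑ n (λ t → f (m ℕ.+ t))
  ∑-++ m zero    f = trans (cong (λ k → ∑ k f) (ℕ.+-identityʳ m)) (sym (ℤ.+-identityʳ (∑ m f)))
  ∑-++ m (suc n) f = begin
    ∑ (m ℕ.+ suc n) f                                   ≡⟨ cong (λ k → ∑ k f) (ℕ.+-suc m n) ⟩
    ∑ (m ℕ.+ n) f + f (suc m ℕ.+ n)                       ≡⟨ cong₂ _+_ (∑-++ m n f) (cong f (sym (ℕ.+-suc m n))) ⟩
    ∑ m f + ∑ n (λ t → f (m ℕ.+ t)) + f (m ℕ.+ suc n)     ≡⟨ ℤ.+-assoc (∑ m f) _ _ ⟩
    ∑ m f + ∑ (suc n) (λ t → f (m ℕ.+ t))                 ∎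
    where open ≡-Reasoning

  ∑-vanishing : ∀ {m n} {f : ℕ → ℤ} → m ≤ n → (∀ {j} → m < j → f j ≡ 0ℤ) → ∑ n f ≡ ∑ m f
  ∑-vanishing {m} {f = f} m≤n f≡0 with ℕ.m≤n⇒∃[o]m+o≡n m≤n
  ... | o , refl = begin
    ∑ (m ℕ.+ o) f                         ≡⟨ ∑-++ m o f ⟩
    ∑ m f + ∑ o (λ t → f (m ℕ.+ t))       ≡⟨ cong (λ s → ∑ m f + s) (∑-zero o (λ 1≤t _ → f≡0 (ℕ.m<m+n m 1≤t))) ⟩
    ∑ m f + 0ℤ                            ≡⟨ ℤ.+-identityʳ (∑ m f) ⟩
    ∑ m f                                 ∎
    where open ≡-Reasoning

  foldr-applyUpTo : ∀ n (f : ℕ → ℤ) → foldr _+_ 0ℤ (applyUpTo (f ∘ suc) n) ≡ ∑ n f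
  foldr-applyUpTo zero    f = refl
  foldr-applyUpTo (suc n) f = trans (cong (λ s → f 1 + s) (foldr-applyUpTo n (f ∘ suc))) (sym (∑-unshift n f))

  ∑-multiples : ∀ ℓ .{{_ : NonZero ℓ}} M (h : ℕ → ℤ) →
                ∑ (M ℕ.* ℓ) (λ j → if does (ℓ ∣? j) then h (j ℕ./ ℓ) else 0ℤ) ≡ ∑ M h
  ∑-multiples ℓ zero    h = refl
  ∑-multiples ℓ@(suc ℓ′) (suc M) h = begin
    ∑ (ℓ ℕ.+ M ℕ.* ℓ) F                                ≡⟨ cong (λ k → ∑ k F) (ℕ.+-comm ℓ (M ℕ.* ℓ)) ⟩
    ∑ (M ℕ.* ℓ ℕ.+ ℓ) F                                ≡⟨ ∑-++ (M ℕ.* ℓ) ℓ F ⟩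
    ∑ (M ℕ.* ℓ) F + (∑ ℓ′ (F ∘ (M ℕ.* ℓ ℕ.+_)) + F (M ℕ.* ℓ ℕ.+ ℓ))
      ≡⟨ cong₂ (λ s t → s + (t + F (M ℕ.* ℓ ℕ.+ ℓ))) (∑-multiples ℓ M h) (∑-zero ℓ′ not-multiple) ⟩
    ∑ M h + (0ℤ + F (M ℕ.* ℓ ℕ.+ ℓ))                   ≡⟨ cong (λ s → ∑ M h + s) (trans (ℤ.+-identityˡ _) multiple) ⟩
    ∑ M h + h (suc M)                                  ∎
    where
    open ≡-Reasoning
    F : ℕ → ℤ
    F j = if does (ℓ ∣? j) then h (j ℕ./ ℓ) else 0ℤ
    not-multiple : ∀ {t} → 1 ≤ t → t ≤ ℓ′ → F (M ℕ.* ℓ ℕ.+ t) ≡ 0ℤ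
    not-multiple {t} 1≤t t<ℓ rewrite dec-false (ℓ ∣? M ℕ.* ℓ ℕ.+ t)
      (λ ℓ∣ → ℕ.<⇒≱ (s≤s t<ℓ) (∣⇒≤ ⦃ ℕ.>-nonZero 1≤t ⦄ (∣m+n∣m⇒∣n ℓ∣ (n∣m*n M)))) = refl
    multiple : F (M ℕ.* ℓ ℕ.+ ℓ) ≡ h (suc M)
    multiple rewrite ℕ.+-comm (M ℕ.* ℓ) ℓ | dec-true (ℓ ∣? ℓ ℕ.+ M ℕ.* ℓ) (n∣m*n (suc M)) =
      cong h (m*n/n≡m (suc M) ℓ)

  ∑-𝟙-≡ : ∀ {ℓ n} → 1 ≤ ℓ → ℓ ≤ n → ∑ n (λ j → 𝟙 (does (j ℕ.≟ ℓ))) ≡ 1ℤ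
  ∑-𝟙-≡ {ℓ@(suc ℓ′)} {n} _ ℓ≤n = begin
    ∑ n (λ j → 𝟙 (does (j ℕ.≟ ℓ)))                       ≡⟨ ∑-vanishing ℓ≤n above ⟩
    ∑ ℓ′ (λ j → 𝟙 (does (j ℕ.≟ ℓ))) + 𝟙 (does (ℓ ℕ.≟ ℓ))  ≡⟨ cong₂ _+_ (∑-zero ℓ′ below) (cong 𝟙 (dec-true (ℓ ℕ.≟ ℓ) refl)) ⟩
    1ℤ                                                   ∎
    where
    open ≡-Reasoning
    above : ∀ {j} → ℓ < j → 𝟙 (does (j ℕ.≟ ℓ)) ≡ 0ℤ
    above ℓ<j = cong 𝟙 (dec-false (_ ℕ.≟ ℓ) (ℕ.>⇒≢ ℓ<j))
    below : ∀ {j} → 1 ≤ j → j ≤ ℓ′ → 𝟙 (does (j ℕ.≟ ℓ)) ≡ 0ℤ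
    below _ j≤ℓ′ = cong 𝟙 (dec-false (_ ℕ.≟ ℓ) (ℕ.<⇒≢ (s≤s j≤ℓ′)))

  -- Divisibility and prime factors

  prime∣prime⇒≡ : ∀ {p ℓ} → Prime p → Prime ℓ → p ∣ ℓ → p ≡ ℓ
  prime∣prime⇒≡ pp pℓ p∣ℓ with prime⇒irreducible pℓ p∣ℓ
  ... | inj₁ refl = ⊥-elim (ℕ.nonTrivial⇒≢1 ⦃ prime⇒nonTrivial pp ⦄ refl)
  ... | inj₂ p≡ℓ  = p≡ℓ

  prime∤⇒coprime : ∀ {ℓ m} → Prime ℓ → ¬ ℓ ∣ m → Coprime m ℓ
  prime∤⇒coprime pℓ ℓ∤m (i∣m , i∣ℓ) with prime⇒irreducible pℓ i∣ℓ
  ... | inj₁ i≡1  = i≡1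
  ... | inj₂ refl = ⊥-elim (ℓ∤m i∣m)

  ∣ℓ^a*m⇒∣m : ∀ {ℓ j m} → Prime ℓ → ¬ ℓ ∣ j → ∀ a → j ∣ ℓ ℕ.^ a ℕ.* m → j ∣ m
  ∣ℓ^a*m⇒∣m {j = j} {m} pℓ ℓ∤j zero    j∣m = subst (j ∣_) (ℕ.*-identityˡ m) j∣m
  ∣ℓ^a*m⇒∣m {ℓ} {j} {m} pℓ ℓ∤j (suc a) j∣ℓ^a*m = ∣ℓ^a*m⇒∣m pℓ ℓ∤j a
    (coprime-divisor (prime∤⇒coprime pℓ ℓ∤j) (subst (j ∣_) (ℕ.*-assoc ℓ (ℓ ℕ.^ a) m) j∣ℓ^a*m))

  ℓ^a∣m*n⇒ℓ^a∣n : ∀ {ℓ m} → Prime ℓ → ¬ ℓ ∣ m → ∀ a {n} → ℓ ℕ.^ a ∣ m ℕ.* n → ℓ ℕ.^ a ∣ n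
  ℓ^a∣m*n⇒ℓ^a∣n pℓ ℓ∤m zero    {n} _ = 1∣ n
  ℓ^a∣m*n⇒ℓ^a∣n {ℓ} {m} pℓ ℓ∤m (suc a) {n} ℓ^[1+a]∣m*n
    with euclidsLemma m n pℓ (∣-trans (m∣m*n (ℓ ℕ.^ a)) ℓ^[1+a]∣m*n)
  ... | inj₁ ℓ∣m = ⊥-elim (ℓ∤m ℓ∣m)
  ... | inj₂ (divides k refl) = subst (ℓ ℕ.^ suc a ∣_) (ℕ.*-comm ℓ k) (*-monoʳ-∣ ℓ (ℓ^a∣m*n⇒ℓ^a∣n pℓ ℓ∤m a ℓ^a∣m*k))
    where
    ℓ^a∣m*k : ℓ ℕ.^ a ∣ m ℕ.* k
    ℓ^a∣m*k = *-cancelˡ-∣ ℓ ⦃ prime⇒nonZero pℓ ⦄ (subst (ℓ ℕ.^ suc a ∣_) (x∙yz≈z∙xy m k ℓ) ℓ^[1+a]∣m*n)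

  ℓ^a∣∧m∣⇒ℓ^a*m∣ : ∀ {ℓ m N} → Prime ℓ → ¬ ℓ ∣ m → ∀ a → + (ℓ ℕ.^ a) ∣ℤ N → + m ∣ℤ N → + (ℓ ℕ.^ a ℕ.* m) ∣ℤ N
  ℓ^a∣∧m∣⇒ℓ^a*m∣ {ℓ} {m} {N} pℓ ℓ∤m a ℓ^a∣N m∣N with ℤ∣.∣⇒∣ᵤ m∣N
  ... | divides t ∣N∣≡t*m = ℤ∣.∣ᵤ⇒∣ (subst (ℓ ℕ.^ a ℕ.* m ∣_) (sym ∣N∣≡t*m) (*-monoˡ-∣ m ℓ^a∣t))
    where
    ℓ^a∣t : ℓ ℕ.^ a ∣ t
    ℓ^a∣t = ℓ^a∣m*n⇒ℓ^a∣n pℓ ℓ∤m a (subst (ℓ ℕ.^ a ∣_) (trans ∣N∣≡t*m (ℕ.*-comm t m)) (ℤ∣.∣⇒∣ᵤ ℓ^a∣N))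

  ℓ^[k+a]∣n*[ℓ^a*m]⇒ℓ^k∣n : ∀ {ℓ m} → Prime ℓ → ¬ ℓ ∣ m → ∀ k a {n} →
                            ℓ ℕ.^ (k ℕ.+ a) ∣ n ℕ.* (ℓ ℕ.^ a ℕ.* m) → ℓ ℕ.^ k ∣ n
  ℓ^[k+a]∣n*[ℓ^a*m]⇒ℓ^k∣n {ℓ} {m} pℓ ℓ∤m k a {n} ℓ^[k+a]∣ = ℓ^a∣m*n⇒ℓ^a∣n pℓ ℓ∤m k
    (*-cancelˡ-∣ (ℓ ℕ.^ a) ⦃ ℕ.m^n≢0 ℓ a ⦃ prime⇒nonZero pℓ ⦄ ⦄
      (subst₂ _∣_ (trans (ℕ.^-distribˡ-+-* ℓ k a) (ℕ.*-comm (ℓ ℕ.^ k) (ℓ ℕ.^ a))) (x∙yz≈y∙zx n (ℓ ℕ.^ a) m) ℓ^[k+a]∣))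

  ∤⇒∤^ : ∀ {ℓ m} → Prime ℓ → ¬ ℓ ∣ m → ∀ s → ¬ ℓ ∣ m ℕ.^ s
  ∤⇒∤^ pℓ ℓ∤m zero    ℓ∣1 = ℕ.nonTrivial⇒≢1 ⦃ prime⇒nonTrivial pℓ ⦄ (∣1⇒≡1 ℓ∣1)
  ∤⇒∤^ {m = m} pℓ ℓ∤m (suc s) ℓ∣m^[1+s] with euclidsLemma m (m ℕ.^ s) pℓ ℓ∣m^[1+s]
  ... | inj₁ ℓ∣m   = ℓ∤m ℓ∣m
  ... | inj₂ ℓ∣m^s = ∤⇒∤^ pℓ ℓ∤m s ℓ∣m^s

  ^-monoʳ-∣ : ∀ m {b e} → b ≤ e → m ℕ.^ b ∣ m ℕ.^ e
  ^-monoʳ-∣ m {b} b≤e with ℕ.m≤n⇒∃[o]m+o≡n b≤e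
  ... | o , refl = subst (m ℕ.^ b ∣_) (sym (ℕ.^-distribˡ-+-* m b o)) (m∣m*n (m ℕ.^ o))

  2+a≤2^[1+a] : ∀ a → 2 ℕ.+ a ≤ 2 ℕ.^ suc a
  2+a≤2^[1+a] zero    = ℕ.≤-refl
  2+a≤2^[1+a] (suc a) = subst (3 ℕ.+ a ≤_) (cong (2 ℕ.^ suc a ℕ.+_) (sym (ℕ.+-identityʳ _)))
    (ℕ.+-mono-≤ (ℕ.m^n>0 2 (suc a)) (2+a≤2^[1+a] a))

  divisor-nonZero : ∀ {c n} .{{_ : NonZero n}} → c ∣ n → NonZero c
  divisor-nonZero {n = n} c∣n = ℕ.≢-nonZero (λ { refl → ℕ.≢-nonZero⁻¹ n (0∣⇒≡0 c∣n) })

  factor-out : ∀ ℓ .{{_ : NonTrivial ℓ}} n .{{_ : NonZero n}} → ∃₂ λ a m → ¬ ℓ ∣ m × n ≡ ℓ ℕ.^ a ℕ.* m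
  factor-out ℓ n = go n (<-wellFounded n)
    where
    go : ∀ n .{{_ : NonZero n}} → Acc _<_ n → ∃₂ λ a m → ¬ ℓ ∣ m × n ≡ ℓ ℕ.^ a ℕ.* m
    go n (acc rec) with ℓ ∣? n
    ... | no ℓ∤n = 0 , n , ℓ∤n , sym (ℕ.*-identityˡ n)
    ... | yes (divides k refl) with go k ⦃ k≢0 ⦄ (rec (ℕ.m<m*n k ℓ ⦃ k≢0 ⦄ (ℕ.nonTrivial⇒n>1 ℓ)))
      where k≢0 = ℕ.m*n≢0⇒m≢0 k
    ...   | a , m , ℓ∤m , refl = suc a , m , ℓ∤m , trans (ℕ.*-comm (ℓ ℕ.^ a ℕ.* m) ℓ) (sym (ℕ.*-assoc ℓ (ℓ ℕ.^ a) m))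

  prime-divisor : ∀ n → 2 ≤ n → ∃[ ℓ ] Prime ℓ × ℓ ∣ n
  prime-divisor 1 (s≤s ())
  prime-divisor n@(suc (suc _)) _ with factorise n
  ... | record { factors = ℓ ∷ ℓs ; isFactorisation = n≡ ; factorsPrime = pℓ ∷ _ } =
    ℓ , pℓ , subst (ℓ ∣_) (sym n≡) (m∣m*n _)

  prime-power-part : ∀ n → 2 ≤ n → ∃[ ℓ ] ∃₂ λ a m → Prime ℓ × ¬ ℓ ∣ m × NonZero m × n ≡ ℓ ℕ.^ suc a ℕ.* m
  prime-power-part 1 (s≤s ())
  prime-power-part n@(suc (suc _)) 2≤n with prime-divisor n 2≤n
  ... | ℓ , pℓ , ℓ∣n with factor-out ℓ ⦃ prime⇒nonTrivial pℓ ⦄ n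
  ...   | zero  , m , ℓ∤m , n≡m   = ⊥-elim (ℓ∤m (subst (ℓ ∣_) (trans n≡m (ℕ.*-identityˡ m)) ℓ∣n))
  ...   | suc a , m , ℓ∤m , n≡ℓ^a*m =
    ℓ , a , m , pℓ , ℓ∤m , ℕ.m*n≢0⇒n≢0 (ℓ ℕ.^ suc a) ⦃ subst NonZero n≡ℓ^a*m _ ⦄ , n≡ℓ^a*m

  -- The Möbius function

  SquareFree : ℕ → Set
  SquareFree n = ∀ {p} → Prime p → ¬ p ℕ.* p ∣ n

  squarefree-* : ∀ {ℓ i} → Prime ℓ → ¬ ℓ ∣ i → SquareFree i → SquareFree (ℓ ℕ.* i)
  squarefree-* {ℓ} {i} pℓ ℓ∤i sf {p} pp p²∣ℓi with p ℕ.≟ ℓ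
  ... | yes refl = ℓ∤i (*-cancelˡ-∣ ℓ ⦃ prime⇒nonZero pℓ ⦄ p²∣ℓi)
  ... | no p≢ℓ  = sf pp (coprime-divisor (prime∤⇒coprime pℓ ℓ∤p²) p²∣ℓi)
    where
    ℓ∤p² : ¬ ℓ ∣ p ℕ.* p
    ℓ∤p² ℓ∣p² = p≢ℓ (sym (prime∣prime⇒≡ pℓ pp (reduce (euclidsLemma p p pℓ ℓ∣p²))))

  ∈⇒nonNull : ∀ {x : ℕ} {xs} → x ∈ xs → null xs ≡ false
  ∈⇒nonNull (here _)  = refl
  ∈⇒nonNull (there _) = refl

  ∈-primeDivisors : ∀ {p n} .{{_ : NonZero n}} → Prime p → p ∣ n → p ∈ primeDivisors n
  ∈-primeDivisors {zero}  pp _ with () ← prime⇒nonZero pp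
  ∈-primeDivisors {suc k} pp p∣n =
    ∈-filter⁺ prime? (∈-filter⁺ (_∣? _) (∈-map⁺ suc (∈-upTo⁺ (∣⇒≤ p∣n))) p∣n) pp

  squarePrimeDivisors : ℕ → List ℕ
  squarePrimeDivisors n = filter (λ p → (p ℕ.* p) ∣? n) (primeDivisors n)

  ∈-squarePrimeDivisors : ∀ {p n} .{{_ : NonZero n}} → Prime p → p ℕ.* p ∣ n → p ∈ squarePrimeDivisors n
  ∈-squarePrimeDivisors {p} {n} pp p²∣n =
    ∈-filter⁺ (λ p → (p ℕ.* p) ∣? n) (∈-primeDivisors pp (∣-trans (m∣m*n p) p²∣n)) p²∣n

  μ-squareful : ∀ {p n} .{{_ : NonZero n}} → Prime p → p ℕ.* p ∣ n → μ n ≡ 0ℤ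
  μ-squareful {p} {n} pp p²∣n = cong (λ b → if b then -1ℤ ^ length (primeDivisors n) else 0ℤ)
    (∈⇒nonNull (∈-squarePrimeDivisors pp p²∣n))

  μ-squarefree : ∀ {n} → SquareFree n → μ n ≡ -1ℤ ^ length (primeDivisors n)
  μ-squarefree {n} sf = cong (λ ps → if null ps then -1ℤ ^ length (primeDivisors n) else 0ℤ)
    (filter-none (λ p → (p ℕ.* p) ∣? n) (All.map sf (all-filter prime? (divisors n))))

  squarefree? : ∀ n .{{_ : NonZero n}} → SquareFree n ⊎ ∃[ p ] Prime p × p ℕ.* p ∣ n
  squarefree? n with squarePrimeDivisors n in eq
  ... | []    = inj₁ λ pp p²∣n → case subst (_ ∈_) eq (∈-squarePrimeDivisors pp p²∣n) of λ ()
  ... | p ∷ _ with ∈-filter⁻ (λ p → (p ℕ.* p) ∣? n) {xs = primeDivisors n} (subst (p ∈_) (sym eq) (here refl))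
  ...   | p∈ , p²∣n = inj₂ (p , proj₂ (∈-filter⁻ prime? {xs = divisors n} p∈) , p²∣n)

  isPrimeDivisor : ℕ → ℕ → Bool
  isPrimeDivisor n j = does (prime? j) ∧ does (j ∣? n)

  length-primeDivisors : ∀ n → + length (primeDivisors n) ≡ ∑ n (𝟙 ∘ isPrimeDivisor n)
  length-primeDivisors n = begin
    + length (primeDivisors n)                             ≡⟨ count (map suc (upTo n)) ⟩
    foldr _+_ 0ℤ (map (𝟙 ∘ isPrimeDivisor n) (map suc (upTo n))) ≡⟨ cong (foldr _+_ 0ℤ) (sym (map-∘ (upTo n))) ⟩
    foldr _+_ 0ℤ (map (𝟙 ∘ isPrimeDivisor n ∘ suc) (upTo n)) ≡⟨ cong (foldr _+_ 0ℤ) (map-upTo _ n) ⟩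
    foldr _+_ 0ℤ (applyUpTo (𝟙 ∘ isPrimeDivisor n ∘ suc) n) ≡⟨ foldr-applyUpTo n (𝟙 ∘ isPrimeDivisor n) ⟩
    ∑ n (𝟙 ∘ isPrimeDivisor n)                             ∎
    where
    open ≡-Reasoning
    count : ∀ xs → + length (filter prime? (filter (_∣? n) xs)) ≡ foldr _+_ 0ℤ (map (𝟙 ∘ isPrimeDivisor n) xs)
    count []       = refl
    count (x ∷ xs) with x ∣? n
    ... | no _  rewrite ∧-zeroʳ (does (prime? x)) = trans (count xs) (sym (ℤ.+-identityˡ _))
    ... | yes _ with prime? x
    ...   | yes _ = cong (λ s → 1ℤ + s) (count xs)
    ...   | no _  = trans (count xs) (sym (ℤ.+-identityˡ _))

  isPrimeDivisor-* : ∀ {ℓ i} → Prime ℓ → ¬ ℓ ∣ i → ∀ j →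
                     𝟙 (isPrimeDivisor (ℓ ℕ.* i) j) ≡ 𝟙 (isPrimeDivisor i j) + 𝟙 (does (j ℕ.≟ ℓ))
  isPrimeDivisor-* {ℓ} {i} pℓ ℓ∤i j with j ℕ.≟ ℓ
  ... | yes refl rewrite dec-true (prime? j) pℓ | dec-true (j ∣? j ℕ.* i) (m∣m*n i) | dec-false (j ∣? i) ℓ∤i
                           | dec-true (j ℕ.≟ j) refl = refl
  ... | no j≢ℓ rewrite dec-false (j ℕ.≟ ℓ) j≢ℓ with prime? j
  ...   | no _   = refl
  ...   | yes pj with j ∣? i
  ...     | yes j∣i rewrite dec-true (j ∣? ℓ ℕ.* i) (∣n⇒∣m*n ℓ j∣i) = refl
  ...     | no j∤i  rewrite dec-false (j ∣? ℓ ℕ.* i) (λ j∣ℓi →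
    [ j≢ℓ ∘ prime∣prime⇒≡ pj pℓ , j∤i ]′ (euclidsLemma ℓ i pj j∣ℓi)) = refl

  length-primeDivisors-* : ∀ {ℓ i} .{{_ : NonZero i}} → Prime ℓ → ¬ ℓ ∣ i →
                           length (primeDivisors (ℓ ℕ.* i)) ≡ suc (length (primeDivisors i))
  length-primeDivisors-* {ℓ} {i} pℓ ℓ∤i = ℤ.+-injective (begin
    + length (primeDivisors (ℓ ℕ.* i))                         ≡⟨ length-primeDivisors (ℓ ℕ.* i) ⟩
    ∑ (ℓ ℕ.* i) (𝟙 ∘ isPrimeDivisor (ℓ ℕ.* i))                 ≡⟨ ∑-cong (ℓ ℕ.* i) (isPrimeDivisor-* pℓ ℓ∤i) ⟩
    ∑ (ℓ ℕ.* i) (λ j → 𝟙 (isPrimeDivisor i j) + 𝟙 (does (j ℕ.≟ ℓ))) ≡⟨ ∑-+ (ℓ ℕ.* i) _ _ ⟩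
    ∑ (ℓ ℕ.* i) (𝟙 ∘ isPrimeDivisor i) + ∑ (ℓ ℕ.* i) (λ j → 𝟙 (does (j ℕ.≟ ℓ)))
      ≡⟨ cong₂ _+_ (∑-vanishing i≤ℓi no-large-divisor) (∑-𝟙-≡ (ℕ.>-nonZero⁻¹ ℓ) ℓ≤ℓi) ⟩
    ∑ i (𝟙 ∘ isPrimeDivisor i) + 1ℤ                            ≡⟨ cong (_+ 1ℤ) (length-primeDivisors i) ⟨
    + length (primeDivisors i) + 1ℤ                            ≡⟨ ℤ.+-comm (+ length (primeDivisors i)) 1ℤ ⟩
    + suc (length (primeDivisors i))                           ∎)
    where
    open ≡-Reasoning
    instance _ = prime⇒nonZero pℓ
    i≤ℓi : i ≤ ℓ ℕ.* i
    i≤ℓi = ℕ.m≤n*m i ℓ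
    ℓ≤ℓi : ℓ ≤ ℓ ℕ.* i
    ℓ≤ℓi = ℕ.m≤m*n ℓ i
    no-large-divisor : ∀ {j} → i < j → 𝟙 (isPrimeDivisor i j) ≡ 0ℤ
    no-large-divisor {j} i<j rewrite dec-false (j ∣? i) (ℕ.<⇒≱ i<j ∘ ∣⇒≤) = cong 𝟙 (∧-zeroʳ _)

  μ-prime-* : ∀ {ℓ i} .{{_ : NonZero i}} → Prime ℓ → ¬ ℓ ∣ i → μ (ℓ ℕ.* i) ≡ - μ i
  μ-prime-* {ℓ} {i} pℓ ℓ∤i with squarefree? i
  ... | inj₂ (p , pp , p²∣i) =
    trans (μ-squareful ⦃ ℕ.m*n≢0 ℓ i ⦃ prime⇒nonZero pℓ ⦄ ⦄ pp (∣n⇒∣m*n ℓ p²∣i)) (cong -_ (sym (μ-squareful pp p²∣i)))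
  ... | inj₁ sf = begin
    μ (ℓ ℕ.* i)                                 ≡⟨ μ-squarefree (squarefree-* pℓ ℓ∤i sf) ⟩
    -1ℤ ^ length (primeDivisors (ℓ ℕ.* i))      ≡⟨ cong (-1ℤ ^_) (length-primeDivisors-* pℓ ℓ∤i) ⟩
    -1ℤ * -1ℤ ^ length (primeDivisors i)        ≡⟨ ℤ.-1*i≡-i _ ⟩
    - (-1ℤ ^ length (primeDivisors i))          ≡⟨ cong -_ (μ-squarefree sf) ⟨
    - μ i                                       ∎
    where open ≡-Reasoning

  -- Möbius convolution

  μ⋆-term : (ℕ → ℤ) → ℕ → ℕ → ℤ
  μ⋆-term f n zero      = 0ℤ
  μ⋆-term f n j@(suc _) = if does (j ∣? n) then μ j * f (n ℕ./ j) else 0ℤ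

  μ⋆ : (ℕ → ℤ) → ℕ → ℤ
  μ⋆ f n = ∑ n (μ⋆-term f n)

  μ⋆-term-∣ : ∀ f {n j} .{{_ : NonZero j}} → j ∣ n → μ⋆-term f n j ≡ μ j * f (n ℕ./ j)
  μ⋆-term-∣ f {j = suc _} j∣n rewrite dec-true (_ ∣? _) j∣n = refl

  μ⋆-term-∤ : ∀ f {n j} → ¬ j ∣ n → μ⋆-term f n j ≡ 0ℤ
  μ⋆-term-∤ f {j = zero}  _   = refl
  μ⋆-term-∤ f {j = suc _} j∤n rewrite dec-false (_ ∣? _) j∤n = refl

  μ⋆-term-beyond : ∀ f {n j} .{{_ : NonZero n}} → n < j → μ⋆-term f n j ≡ 0ℤ
  μ⋆-term-beyond f n<j = μ⋆-term-∤ f (ℕ.<⇒≱ n<j ∘ ∣⇒≤)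

  μ⋆-cong : ∀ {f g} n → (∀ c → f c ≡ g c) → μ⋆ f n ≡ μ⋆ g n
  μ⋆-cong {f} {g} n f≗g = ∑-cong n term
    where
    term : ∀ j → μ⋆-term f n j ≡ μ⋆-term g n j
    term zero        = refl
    term j@(suc _) with j ∣? n
    ... | yes j∣n = begin
      μ⋆-term f n j         ≡⟨ μ⋆-term-∣ f j∣n ⟩
      μ j * f (n ℕ./ j)     ≡⟨ cong (μ j *_) (f≗g (n ℕ./ j)) ⟩
      μ j * g (n ℕ./ j)     ≡⟨ μ⋆-term-∣ g j∣n ⟨
      μ⋆-term g n j         ∎
      where open ≡-Reasoning
    ... | no j∤n = trans (μ⋆-term-∤ f j∤n) (sym (μ⋆-term-∤ g j∤n))

  μ⋆-- : ∀ f g n → μ⋆ (λ c → f c - g c) n ≡ μ⋆ f n - μ⋆ g n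
  μ⋆-- f g n = trans (∑-cong n term) (∑-- n (μ⋆-term f n) (μ⋆-term g n))
    where
    term : ∀ j → μ⋆-term (λ c → f c - g c) n j ≡ μ⋆-term f n j - μ⋆-term g n j
    term zero        = refl
    term j@(suc _) with j ∣? n
    ... | yes j∣n = begin
      μ⋆-term (λ c → f c - g c) n j              ≡⟨ μ⋆-term-∣ (λ c → f c - g c) j∣n ⟩
      μ j * (f (n ℕ./ j) - g (n ℕ./ j))          ≡⟨ x[y-z]≈xy-xz (μ j) _ _ ⟩
      μ j * f (n ℕ./ j) - μ j * g (n ℕ./ j)      ≡⟨ cong₂ _-_ (μ⋆-term-∣ f j∣n) (μ⋆-term-∣ g j∣n) ⟨
      μ⋆-term f n j - μ⋆-term g n j              ∎
      where open ≡-Reasoning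
    ... | no j∤n = trans (μ⋆-term-∤ (λ c → f c - g c) j∤n) (sym (cong₂ _-_ (μ⋆-term-∤ f j∤n) (μ⋆-term-∤ g j∤n)))

  μ⋆-∣ : ∀ {k f n} .{{_ : NonZero n}} → (∀ {c} → c ∣ n → k ∣ℤ f c) → k ∣ℤ μ⋆ f n
  μ⋆-∣ {k} {f} {n} k∣f = ∑-∣ n term
    where
    term : ∀ j → k ∣ℤ μ⋆-term f n j
    term zero        = divides 0ℤ refl
    term j@(suc _) with j ∣? n
    ... | yes j∣n = subst (k ∣ℤ_) (sym (μ⋆-term-∣ f j∣n)) (ℤ∣.∣n⇒∣m*n (μ j) (k∣f (m/n∣m j∣n)))
    ... | no j∤n  = subst (k ∣ℤ_) (sym (μ⋆-term-∤ f j∤n)) (divides 0ℤ refl)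

  μ⋆-term-squareful : ∀ f {n j p} .{{_ : NonZero j}} → Prime p → p ℕ.* p ∣ j → μ⋆-term f n j ≡ 0ℤ
  μ⋆-term-squareful f {n} {j} pp p²∣j with j ∣? n
  ... | yes j∣n = trans (μ⋆-term-∣ f j∣n) (cong (_* f (n ℕ./ j)) (μ-squareful pp p²∣j))
  ... | no j∤n  = μ⋆-term-∤ f j∤n

  -- Only the divisors i and ℓ * i of ℓ ^ (1 + a) * m with i ∣ m can have μ ≢ 0, and μ (ℓ * i) = - μ i.
  module _ {ℓ m : ℕ} .{{_ : NonZero m}} (pℓ : Prime ℓ) (ℓ∤m : ¬ ℓ ∣ m) (a : ℕ) (f : ℕ → ℤ) where

    private
      instance
        ℓ≢0 : NonZero ℓ
        ℓ≢0 = prime⇒nonZero pℓ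

      n m′ : ℕ
      n  = ℓ ℕ.^ suc a ℕ.* m
      m′ = ℓ ℕ.^ a ℕ.* m

      n≡m′*ℓ : n ≡ m′ ℕ.* ℓ
      n≡m′*ℓ = trans (ℕ.*-assoc ℓ (ℓ ℕ.^ a) m) (ℕ.*-comm ℓ m′)

      f₁ f₂ : ℕ → ℤ
      f₁ c = f (ℓ ℕ.^ suc a ℕ.* c)
      f₂ c = f (ℓ ℕ.^ a ℕ.* c)

      onMultiples : ℕ → ℤ
      onMultiples j = if does (ℓ ∣? j) then μ⋆-term f₂ m (j ℕ./ ℓ) else 0ℤ

      coprime-term : ∀ j → ¬ ℓ ∣ j → μ⋆-term f n j ≡ μ⋆-term f₁ m j
      coprime-term zero      ℓ∤0 = ⊥-elim (ℓ∤0 (ℓ ∣0))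
      coprime-term j@(suc _) ℓ∤j with j ∣? m
      ... | yes j∣m = begin
        μ⋆-term f n j         ≡⟨ μ⋆-term-∣ f (∣n⇒∣m*n (ℓ ℕ.^ suc a) j∣m) ⟩
        μ j * f (n ℕ./ j)     ≡⟨ cong (λ c → μ j * f c) (*-/-assoc (ℓ ℕ.^ suc a) j∣m) ⟩
        μ j * f₁ (m ℕ./ j)    ≡⟨ μ⋆-term-∣ f₁ j∣m ⟨
        μ⋆-term f₁ m j        ∎
        where open ≡-Reasoning
      ... | no j∤m = trans (μ⋆-term-∤ f (j∤m ∘ ∣ℓ^a*m⇒∣m pℓ ℓ∤j (suc a))) (sym (μ⋆-term-∤ f₁ j∤m))

      multiple-term : ∀ i .{{_ : NonZero i}} → μ⋆-term f n (i ℕ.* ℓ) ≡ - μ⋆-term f₂ m i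
      multiple-term i with ℓ ∣? i
      ... | yes ℓ∣i = trans (μ⋆-term-squareful f ⦃ iℓ≢0 ⦄ pℓ (*-monoˡ-∣ ℓ ℓ∣i))
                            (cong -_ (sym (μ⋆-term-∤ f₂ (ℓ∤m ∘ ∣-trans ℓ∣i))))
        where iℓ≢0 = ℕ.m*n≢0 i ℓ
      ... | no ℓ∤i with i ∣? m
      ...   | yes i∣m = begin
        μ⋆-term f n (i ℕ.* ℓ)                  ≡⟨ μ⋆-term-∣ f iℓ∣n ⟩
        μ (i ℕ.* ℓ) * f (n ℕ./ (i ℕ.* ℓ))      ≡⟨ cong₂ (λ k c → μ k * f c) (ℕ.*-comm i ℓ) cofactor ⟩
        μ (ℓ ℕ.* i) * f₂ (m ℕ./ i)             ≡⟨ cong (_* f₂ (m ℕ./ i)) (μ-prime-* pℓ ℓ∤i) ⟩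
        - μ i * f₂ (m ℕ./ i)                   ≡⟨ ℤ.neg-distribˡ-* (μ i) _ ⟨
        - (μ i * f₂ (m ℕ./ i))                 ≡⟨ cong -_ (μ⋆-term-∣ f₂ i∣m) ⟨
        - μ⋆-term f₂ m i                       ∎
        where
        open ≡-Reasoning
        instance iℓ≢0 = ℕ.m*n≢0 i ℓ
        iℓ∣n : i ℕ.* ℓ ∣ n
        iℓ∣n = subst (i ℕ.* ℓ ∣_) (sym n≡m′*ℓ) (*-monoˡ-∣ ℓ (∣n⇒∣m*n (ℓ ℕ.^ a) i∣m))
        cofactor : n ℕ./ (i ℕ.* ℓ) ≡ ℓ ℕ.^ a ℕ.* (m ℕ./ i)
        cofactor = begin
          n ℕ./ (i ℕ.* ℓ)            ≡⟨ /-congˡ {o = i ℕ.* ℓ} n≡m′*ℓ ⟩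
          m′ ℕ.* ℓ ℕ./ (i ℕ.* ℓ)     ≡⟨ m*n/o*n≡m/o m′ ℓ i ⟩
          m′ ℕ./ i                   ≡⟨ *-/-assoc (ℓ ℕ.^ a) i∣m ⟩
          ℓ ℕ.^ a ℕ.* (m ℕ./ i)      ∎
      ...   | no i∤m = trans (μ⋆-term-∤ f iℓ∤n) (cong -_ (sym (μ⋆-term-∤ f₂ i∤m)))
        where
        iℓ∤n : ¬ i ℕ.* ℓ ∣ n
        iℓ∤n iℓ∣n = i∤m (∣ℓ^a*m⇒∣m pℓ ℓ∤i a (*-cancelʳ-∣ ℓ (subst (i ℕ.* ℓ ∣_) n≡m′*ℓ iℓ∣n)))

      split-term : ∀ j → μ⋆-term f n j ≡ μ⋆-term f₁ m j - onMultiples j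
      split-term j with ℓ ∣? j
      ... | no ℓ∤j = trans (coprime-term j ℓ∤j) (sym (ℤ.+-identityʳ _))
      ... | yes (divides zero refl) rewrite 0/n≡0 ℓ ⦃ ℓ≢0 ⦄ = refl
      ... | yes (divides i@(suc _) refl) rewrite m*n/n≡m i ℓ ⦃ ℓ≢0 ⦄ = begin
        μ⋆-term f n (i ℕ.* ℓ)                          ≡⟨ multiple-term i ⟩
        - μ⋆-term f₂ m i                                ≡⟨ ℤ.+-identityˡ _ ⟨
        0ℤ - μ⋆-term f₂ m i                             ≡⟨ cong (_- μ⋆-term f₂ m i) (μ⋆-term-∤ f₁ iℓ∤m) ⟨
        μ⋆-term f₁ m (i ℕ.* ℓ) - μ⋆-term f₂ m i         ∎
        where
        open ≡-Reasoning
        iℓ∤m : ¬ i ℕ.* ℓ ∣ m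
        iℓ∤m = ℓ∤m ∘ ∣-trans (n∣m*n i)

    μ⋆-split : μ⋆ f (ℓ ℕ.^ suc a ℕ.* m) ≡ μ⋆ (λ c → f (ℓ ℕ.^ suc a ℕ.* c)) m - μ⋆ (λ c → f (ℓ ℕ.^ a ℕ.* c)) m
    μ⋆-split = begin
      ∑ n (μ⋆-term f n)                              ≡⟨ ∑-cong n split-term ⟩
      ∑ n (λ j → μ⋆-term f₁ m j - onMultiples j)      ≡⟨ ∑-- n (μ⋆-term f₁ m) onMultiples ⟩
      ∑ n (μ⋆-term f₁ m) - ∑ n onMultiples            ≡⟨ cong₂ _-_ (∑-vanishing m≤n (μ⋆-term-beyond f₁)) reindex ⟩
      ∑ m (μ⋆-term f₁ m) - ∑ m (μ⋆-term f₂ m)         ∎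
      where
      open ≡-Reasoning
      instance ℓ^a≢0 = ℕ.m^n≢0 ℓ a
      m≤n : m ≤ n
      m≤n = ℕ.m≤n*m m (ℓ ℕ.^ suc a) ⦃ ℕ.m^n≢0 ℓ (suc a) ⦄
      reindex : ∑ n onMultiples ≡ ∑ m (μ⋆-term f₂ m)
      reindex = begin
        ∑ n onMultiples              ≡⟨ cong (λ k → ∑ k onMultiples) n≡m′*ℓ ⟩
        ∑ (m′ ℕ.* ℓ) onMultiples     ≡⟨ ∑-multiples ℓ m′ (μ⋆-term f₂ m) ⟩
        ∑ m′ (μ⋆-term f₂ m)          ≡⟨ ∑-vanishing (ℕ.m≤n*m m (ℓ ℕ.^ a)) (μ⋆-term-beyond f₂) ⟩
        ∑ m (μ⋆-term f₂ m)           ∎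

  μ⋆-const : ∀ c n → 2 ≤ n → μ⋆ (λ _ → c) n ≡ 0ℤ
  μ⋆-const c n 2≤n with prime-power-part n 2≤n
  ... | ℓ , a , m , pℓ , ℓ∤m , m≢0 , refl =
    trans (μ⋆-split ⦃ m≢0 ⦄ pℓ ℓ∤m a (λ _ → c)) (ℤ.+-inverseʳ (μ⋆ (λ _ → c) m))

  μ⋆-sub-const : ∀ f c n → 2 ≤ n → μ⋆ f n ≡ μ⋆ (λ e → f e - c) n
  μ⋆-sub-const f c n 2≤n = sym (begin
    μ⋆ (λ e → f e - c) n         ≡⟨ μ⋆-- f (λ _ → c) n ⟩
    μ⋆ f n - μ⋆ (λ _ → c) n      ≡⟨ cong (λ s → μ⋆ f n - s) (μ⋆-const c n 2≤n) ⟩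
    μ⋆ f n - 0ℤ                  ≡⟨ ℤ.+-identityʳ (μ⋆ f n) ⟩
    μ⋆ f n                       ∎)
    where open ≡-Reasoning

  -- Congruences between powers

  [x^m]^n≡x^[n*m] : ∀ x c e → (x ^ c) ^ e ≡ x ^ (e ℕ.* c)
  [x^m]^n≡x^[n*m] x c e = trans (ℤ.^-*-assoc x c e) (cong (x ^_) (ℕ.*-comm c e))

  *-pres-∣ℤ : ∀ {a b x y} → a ∣ℤ x → b ∣ℤ y → a * b ∣ℤ x * y
  *-pres-∣ℤ {a} {b} (divides q refl) (divides r refl) = divides (q * r) (regroup q a r b)
    where
    regroup : ∀ q a r b → q * a * (r * b) ≡ q * r * (a * b)
    regroup = solve-∀

  geometric : ℤ → ℤ → ℕ → ℤ
  geometric u v zero    = 0ℤ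
  geometric u v (suc n) = u ^ n + v * geometric u v n

  geometric-identity : ∀ u v n → (u - v) * geometric u v n ≡ u ^ n - v ^ n
  geometric-identity u v zero    = ℤ.*-zeroʳ (u - v)
  geometric-identity u v (suc n) = begin
    (u - v) * (u ^ n + v * geometric u v n)            ≡⟨ expand u v (u ^ n) (geometric u v n) ⟩
    (u - v) * u ^ n + v * ((u - v) * geometric u v n)
      ≡⟨ cong (λ t → (u - v) * u ^ n + v * t) (geometric-identity u v n) ⟩
    (u - v) * u ^ n + v * (u ^ n - v ^ n)              ≡⟨ collect u v (u ^ n) (v ^ n) ⟩
    u * u ^ n - v * v ^ n                              ∎
    where
    open ≡-Reasoning
    expand : ∀ u v X G → (u - v) * (X + v * G) ≡ (u - v) * X + v * ((u - v) * G)
    expand = solve-∀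
    collect : ∀ u v X Y → (u - v) * X + v * (X - Y) ≡ u * X - v * Y
    collect = solve-∀

  ∣-sub⇒∣-^-sub : ∀ {k u v} n → k ∣ℤ u - v → k ∣ℤ u ^ n - v ^ n
  ∣-sub⇒∣-^-sub {u = u} {v} n k∣u-v =
    subst (_ ∣ℤ_) (geometric-identity u v n) (ℤ∣.∣m⇒∣m*n (geometric u v n) k∣u-v)

  -- Modulo u - v, each of the n + 1 terms u ^ i * v ^ (n - i) of the geometric sum is congruent to v ^ n.
  geometric-congruence : ∀ {k u v} → k ∣ℤ u - v → ∀ n → k ∣ℤ geometric u v (suc n) - + suc n * v ^ n
  geometric-congruence {v = v} k∣u-v zero = subst (_ ∣ℤ_) (sym (cancel v)) (divides 0ℤ refl)
    where
    cancel : ∀ v → 1ℤ + v * 0ℤ - 1ℤ * 1ℤ ≡ 0ℤ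
    cancel = solve-∀
  geometric-congruence {u = u} {v} k∣u-v (suc n) =
    subst (_ ∣ℤ_) (sym (regroup (u ^ suc n) v (geometric u v (suc n)) (+ suc n) (v ^ n)))
      (ℤ∣.∣m∣n⇒∣m+n (∣-sub⇒∣-^-sub {u = u} {v} (suc n) k∣u-v)
                    (ℤ∣.∣n⇒∣m*n v (geometric-congruence {u = u} {v} k∣u-v n)))
    where
    regroup : ∀ U v G N V → U + v * G - (1ℤ + N) * (v * V) ≡ (U - v * V) + v * (G - N * V)
    regroup = solve-∀

  lift-∣-^-sub : ∀ {ℓ k u v} → + ℓ ∣ℤ u - v → k ∣ℤ u - v → k * + ℓ ∣ℤ u ^ ℓ - v ^ ℓ
  lift-∣-^-sub {zero}       _ _ = divides 0ℤ refl
  lift-∣-^-sub {ℓ@(suc ℓ′)} {k} {u} {v} ℓ∣u-v k∣u-v =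
    subst (_ ∣ℤ_) (geometric-identity u v ℓ) (*-pres-∣ℤ k∣u-v ℓ∣geometric)
    where
    ℓ∣geometric : + ℓ ∣ℤ geometric u v ℓ
    ℓ∣geometric = ℤ∣.∣m+n∣n⇒∣m (geometric-congruence ℓ∣u-v ℓ′) (ℤ∣.∣m⇒∣-m (ℤ∣.∣m⇒∣m*n (v ^ ℓ′) ℤ∣.∣-refl))

  binomialSum : ℤ → ℕ → ℕ → ℤ
  binomialSum x n zero    = 0ℤ
  binomialSum x n (suc m) = binomialSum x n m + + (n C m) * x ^ m

  binomialSum-pascal : ∀ x n m → binomialSum x (suc n) (suc m) ≡ binomialSum x n (suc m) + x * binomialSum x n m
  binomialSum-pascal x n zero    = sym (trans (cong (λ t → binomialSum x n 1 + t) (ℤ.*-zeroʳ x)) (ℤ.+-identityʳ _))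
  binomialSum-pascal x n (suc m) = begin
    binomialSum x (suc n) (suc m) + + (suc n C suc m) * x ^ suc m
      ≡⟨ cong₂ (λ s c → s + + c * x ^ suc m) (binomialSum-pascal x n m) (sym (nCk+nC[k+1]≡[n+1]C[k+1] n m)) ⟩
    binomialSum x n (suc m) + x * binomialSum x n m + (+ (n C m) + + (n C suc m)) * (x * x ^ m)
      ≡⟨ regroup (binomialSum x n (suc m)) (binomialSum x n m) x (+ (n C m)) (+ (n C suc m)) (x ^ m) ⟩
    binomialSum x n (suc m) + + (n C suc m) * x ^ suc m + x * (binomialSum x n m + + (n C m) * x ^ m) ∎
    where
    open ≡-Reasoning
    regroup : ∀ A B x c d X → A + x * B + (c + d) * (x * X) ≡ A + d * (x * X) + x * (B + c * X)
    regroup = solve-∀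

  binomial : ∀ x n → (1ℤ + x) ^ n ≡ binomialSum x n (suc n)
  binomial x zero    = refl
  binomial x (suc n) = begin
    (1ℤ + x) * (1ℤ + x) ^ n                               ≡⟨ cong ((1ℤ + x) *_) (binomial x n) ⟩
    (1ℤ + x) * binomialSum x n (suc n)                     ≡⟨ distrib x (binomialSum x n (suc n)) ⟩
    binomialSum x n (suc n) + x * binomialSum x n (suc n)  ≡⟨ cong (_+ x * binomialSum x n (suc n)) top-term ⟨
    binomialSum x n (suc (suc n)) + x * binomialSum x n (suc n) ≡⟨ binomialSum-pascal x n (suc n) ⟨
    binomialSum x (suc n) (suc (suc n))                    ∎
    where
    open ≡-Reasoning
    distrib : ∀ x B → (1ℤ + x) * B ≡ B + x * B
    distrib = solve-∀
    top-term : binomialSum x n (suc (suc n)) ≡ binomialSum x n (suc n)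
    top-term = trans (cong (λ c → binomialSum x n (suc n) + + c * x ^ suc n) (k>n⇒nCk≡0 (ℕ.n<1+n n)))
                     (ℤ.+-identityʳ _)

  prime∤! : ∀ {ℓ m} → Prime ℓ → m < ℓ → ¬ ℓ ∣ m !
  prime∤! {m = zero}  pℓ _   ℓ∣1 = ℕ.nonTrivial⇒≢1 ⦃ prime⇒nonTrivial pℓ ⦄ (∣1⇒≡1 ℓ∣1)
  prime∤! {m = suc m} pℓ m<ℓ ℓ∣m! with euclidsLemma (suc m) (m !) pℓ ℓ∣m!
  ... | inj₁ ℓ∣1+m = ℕ.<⇒≱ m<ℓ (∣⇒≤ ℓ∣1+m)
  ... | inj₂ ℓ∣m!′ = prime∤! pℓ (ℕ.<-trans (ℕ.n<1+n m) m<ℓ) ℓ∣m!′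

  prime∣C : ∀ {ℓ k} → Prime ℓ → 0 < k → k < ℓ → ℓ ∣ ℓ C k
  prime∣C {ℓ@(suc ℓ′)} {k} pℓ 0<k k<ℓ with euclidsLemma (ℓ C k) (k ! ℕ.* (ℓ ℕ.∸ k) !) pℓ ℓ∣C*k!*[ℓ-k]!
    where
    instance _ = k ℕ.!* (ℓ ℕ.∸ k) !≢0
    ℓ∣C*k!*[ℓ-k]! : ℓ ∣ (ℓ C k) ℕ.* (k ! ℕ.* (ℓ ℕ.∸ k) !)
    ℓ∣C*k!*[ℓ-k]! = subst (ℓ ∣_)
      (sym (trans (cong (ℕ._* (k ! ℕ.* (ℓ ℕ.∸ k) !)) (nCk≡n!/k![n-k]! (ℕ.<⇒≤ k<ℓ)))
                  (m/n*n≡m (k![n∸k]!∣n! (ℕ.<⇒≤ k<ℓ)))))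
      (m∣m*n (ℓ′ !))
  ... | inj₁ ℓ∣C = ℓ∣C
  ... | inj₂ ℓ∣k!*[ℓ-k]! with euclidsLemma (k !) ((ℓ ℕ.∸ k) !) pℓ ℓ∣k!*[ℓ-k]!
  ...   | inj₁ ℓ∣k!     = ⊥-elim (prime∤! pℓ k<ℓ ℓ∣k!)
  ...   | inj₂ ℓ∣[ℓ-k]! = ⊥-elim (prime∤! pℓ (ℕ.∸-monoʳ-< 0<k (ℕ.<⇒≤ k<ℓ)) ℓ∣[ℓ-k]!)

  ℓ∣binomialSum-1 : ∀ {ℓ} → Prime ℓ → ∀ x {m} → 0 < m → m ≤ ℓ → + ℓ ∣ℤ binomialSum x ℓ m - 1ℤ
  ℓ∣binomialSum-1 pℓ x {1}           _ _     = divides 0ℤ refl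
  ℓ∣binomialSum-1 {ℓ} pℓ x {suc (suc m)} _ 2+m≤ℓ =
    subst (+ ℓ ∣ℤ_) (sym (regroup (binomialSum x ℓ (suc m)) (+ (ℓ C suc m)) (x ^ suc m)))
      (ℤ∣.∣m∣n⇒∣m+n (ℓ∣binomialSum-1 pℓ x (s≤s z≤n) (ℕ.<⇒≤ 2+m≤ℓ))
                    (ℤ∣.∣m⇒∣m*n (x ^ suc m) (ℤ∣.∣ᵤ⇒∣ {+ ℓ} {+ (ℓ C suc m)} (prime∣C pℓ (s≤s z≤n) 2+m≤ℓ))))
    where
    regroup : ∀ B c X → B + c * X - 1ℤ ≡ B - 1ℤ + c * X
    regroup = solve-∀

  freshmansDream : ∀ {ℓ} → Prime ℓ → ∀ x → + ℓ ∣ℤ (1ℤ + x) ^ ℓ - 1ℤ - x ^ ℓ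
  freshmansDream {ℓ} pℓ x =
    subst (_ ∣ℤ_) (sym expansion) (ℓ∣binomialSum-1 pℓ x (ℕ.>-nonZero⁻¹ ℓ ⦃ prime⇒nonZero pℓ ⦄) ℕ.≤-refl)
    where
    open ≡-Reasoning
    cancel : ∀ B X → B + 1ℤ * X - 1ℤ - X ≡ B - 1ℤ
    cancel = solve-∀
    expansion : (1ℤ + x) ^ ℓ - 1ℤ - x ^ ℓ ≡ binomialSum x ℓ ℓ - 1ℤ
    expansion = begin
      (1ℤ + x) ^ ℓ - 1ℤ - x ^ ℓ                              ≡⟨ cong (λ y → y - 1ℤ - x ^ ℓ) (binomial x ℓ) ⟩
      binomialSum x ℓ ℓ + + (ℓ C ℓ) * x ^ ℓ - 1ℤ - x ^ ℓ
        ≡⟨ cong (λ c → binomialSum x ℓ ℓ + + c * x ^ ℓ - 1ℤ - x ^ ℓ) (nCn≡1 ℓ) ⟩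
      binomialSum x ℓ ℓ + 1ℤ * x ^ ℓ - 1ℤ - x ^ ℓ             ≡⟨ cancel (binomialSum x ℓ ℓ) (x ^ ℓ) ⟩
      binomialSum x ℓ ℓ - 1ℤ                                 ∎

  fermat : ∀ {ℓ} → Prime ℓ → ∀ x → + ℓ ∣ℤ x ^ ℓ - x
  fermat {zero}      pℓ _ with () ← prime⇒nonZero pℓ
  fermat {ℓ@(suc _)} pℓ x = subst (_ ∣ℤ_) (sym (regroup x (+ r) (x ^ ℓ) ((+ r) ^ ℓ)))
    (ℤ∣.∣m∣n⇒∣m-n (ℤ∣.∣m∣n⇒∣m+n (∣-sub⇒∣-^-sub {u = x} ℓ ℓ∣x-r) (fermatℕ r)) ℓ∣x-r)
    where
    fermatℕ : ∀ n → + ℓ ∣ℤ (+ n) ^ ℓ - + n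
    fermatℕ zero    = divides 0ℤ refl
    fermatℕ (suc n) = subst (_ ∣ℤ_) (sym (shift ((+ suc n) ^ ℓ) (+ n) ((+ n) ^ ℓ)))
      (ℤ∣.∣m∣n⇒∣m+n (freshmansDream pℓ (+ n)) (fermatℕ n))
      where
      shift : ∀ A Y Z → A - (1ℤ + Y) ≡ A - 1ℤ - Z + (Z - Y)
      shift = solve-∀
    r = x %ℕ ℓ
    ℓ∣x-r : + ℓ ∣ℤ x - + r
    ℓ∣x-r = divides (x /ℕ ℓ) (trans (cong (_- + r) (a≡a%ℕn+[a/ℕn]*n x ℓ)) (cancel (+ r) _))
      where
      cancel : ∀ R Q → R + Q - R ≡ Q
      cancel = solve-∀
    regroup : ∀ X R XL RL → XL - X ≡ XL - RL + (RL - R) - (X - R)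
    regroup = solve-∀

  +ℓ^c*+ℓ≡+ℓ^[1+c] : ∀ ℓ c → + (ℓ ℕ.^ c) * + ℓ ≡ + (ℓ ℕ.^ suc c)
  +ℓ^c*+ℓ≡+ℓ^[1+c] ℓ c = trans (ℤ.*-comm (+ (ℓ ℕ.^ c)) (+ ℓ)) (sym (ℤ.pos-* ℓ (ℓ ℕ.^ c)))

  ℓ^[1+b]∣x^ℓ^[1+b]-x^ℓ^b : ∀ {ℓ} → Prime ℓ → ∀ x b → + (ℓ ℕ.^ suc b) ∣ℤ x ^ (ℓ ℕ.^ suc b) - x ^ (ℓ ℕ.^ b)
  ℓ^[1+b]∣x^ℓ^[1+b]-x^ℓ^b {ℓ} pℓ x zero =
    subst₂ (λ k e → + k ∣ℤ x ^ e - x ^ 1) (sym (ℕ.*-identityʳ ℓ)) (sym (ℕ.*-identityʳ ℓ))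
      (subst (λ y → + ℓ ∣ℤ x ^ ℓ - y) (sym (ℤ.^-identityʳ x)) (fermat pℓ x))
  ℓ^[1+b]∣x^ℓ^[1+b]-x^ℓ^b {ℓ} pℓ x (suc b) =
    subst₂ _∣ℤ_ (+ℓ^c*+ℓ≡+ℓ^[1+c] ℓ (suc b))
                (cong₂ _-_ ([x^m]^n≡x^[n*m] x (ℓ ℕ.^ suc b) ℓ) ([x^m]^n≡x^[n*m] x (ℓ ℕ.^ b) ℓ))
      (lift-∣-^-sub (ℤ∣.∣-trans (ℤ∣.∣ᵤ⇒∣ {+ ℓ} {+ (ℓ ℕ.^ suc b)} (m∣m*n (ℓ ℕ.^ b))) IH) IH)
    where
    IH = ℓ^[1+b]∣x^ℓ^[1+b]-x^ℓ^b pℓ x b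

  odd⇒≡1+2* : ∀ {x} → ¬ 2 ∣ x → x ≡ suc (x ℕ./ 2 ℕ.* 2)
  odd⇒≡1+2* {x} 2∤x with x ℕ.% 2 | m≡m%n+[m/n]*n x 2 | m%n<n x 2
  ... | 0           | x≡ | _ = ⊥-elim (2∤x (divides (x ℕ./ 2) x≡))
  ... | 1           | x≡ | _ = x≡
  ... | suc (suc _) | _  | s≤s (s≤s ())

  2∣n*[1+n] : ∀ n → 2 ∣ n ℕ.* suc n
  2∣n*[1+n] n with 2 ∣? n
  ... | yes 2∣n = ∣m⇒∣m*n (suc n) 2∣n
  ... | no 2∤n  = ∣n⇒∣m*n n (divides (suc (n ℕ./ 2)) (cong suc (odd⇒≡1+2* 2∤n)))

  8∣x²-1 : ∀ {x} → ¬ 2 ∣ x → + 8 ∣ℤ (+ x) ^ 2 - 1ℤ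
  8∣x²-1 {x} 2∤x = subst (+ 8 ∣ℤ_) (sym square) (ℤ∣.*-monoʳ-∣ (+ 4) (ℤ∣.∣ᵤ⇒∣ {+ 2} {+ (y ℕ.* suc y)} (2∣n*[1+n] y)))
    where
    open ≡-Reasoning
    y = x ℕ./ 2
    expand : ∀ Y → (1ℤ + Y * + 2) * ((1ℤ + Y * + 2) * 1ℤ) - 1ℤ ≡ + 4 * (Y * (1ℤ + Y))
    expand = solve-∀
    square : (+ x) ^ 2 - 1ℤ ≡ + 4 * + (y ℕ.* suc y)
    square = begin
      (+ x) ^ 2 - 1ℤ                                         ≡⟨ cong (λ z → (+ z) ^ 2 - 1ℤ) (odd⇒≡1+2* 2∤x) ⟩
      (1ℤ + + (y ℕ.* 2)) ^ 2 - 1ℤ                            ≡⟨ cong (λ z → (1ℤ + z) ^ 2 - 1ℤ) (ℤ.pos-* y 2) ⟩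
      (1ℤ + + y * + 2) * ((1ℤ + + y * + 2) * 1ℤ) - 1ℤ         ≡⟨ expand (+ y) ⟩
      + 4 * (+ y * (1ℤ + + y))                              ≡⟨ cong (+ 4 *_) (ℤ.pos-* y (suc y)) ⟨
      + 4 * + (y ℕ.* suc y)                                  ∎

  2^[3+k]∣x^2^[1+k]-1 : ∀ {x} → ¬ 2 ∣ x → ∀ k → + (2 ℕ.^ (3 ℕ.+ k)) ∣ℤ (+ x) ^ (2 ℕ.^ suc k) - 1ℤ
  2^[3+k]∣x^2^[1+k]-1 2∤x zero    = 8∣x²-1 2∤x
  2^[3+k]∣x^2^[1+k]-1 {x} 2∤x (suc k) =
    subst₂ (λ c y → c ∣ℤ y - 1ℤ) (+ℓ^c*+ℓ≡+ℓ^[1+c] 2 (3 ℕ.+ k)) ([x^m]^n≡x^[n*m] (+ x) (2 ℕ.^ (suc k)) 2)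
      (lift-∣-^-sub {u = (+ x) ^ (2 ℕ.^ suc k)} {v = 1ℤ}
        (ℤ∣.∣-trans (ℤ∣.∣ᵤ⇒∣ {+ 2} {+ (2 ℕ.^ (3 ℕ.+ k))} (m∣m*n (2 ℕ.^ (2 ℕ.+ k)))) IH) IH)
    where
    IH = 2^[3+k]∣x^2^[1+k]-1 2∤x k

  2^[3+k]∣x^[2^k*c]-x^2^k : ∀ {x c} → ¬ 2 ∣ x → ¬ 2 ∣ c → ∀ k →
                        + (2 ℕ.^ (3 ℕ.+ k)) ∣ℤ (+ x) ^ (2 ℕ.^ k ℕ.* c) - (+ x) ^ (2 ℕ.^ k)
  2^[3+k]∣x^[2^k*c]-x^2^k {x} {c} 2∤x 2∤c k =
    subst (+ (2 ℕ.^ (3 ℕ.+ k)) ∣ℤ_) (sym factor) (ℤ∣.∣n⇒∣m*n y (∣-sub⇒∣-^-sub r y²≡1))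
    where
    open ≡-Reasoning
    y = (+ x) ^ (2 ℕ.^ k)
    r = c ℕ./ 2
    y²≡1 : + (2 ℕ.^ (3 ℕ.+ k)) ∣ℤ y ^ 2 - 1ℤ
    y²≡1 = subst (λ z → + (2 ℕ.^ (3 ℕ.+ k)) ∣ℤ z - 1ℤ) (sym ([x^m]^n≡x^[n*m] (+ x) (2 ℕ.^ k) 2))
             (2^[3+k]∣x^2^[1+k]-1 2∤x k)
    pull : ∀ y Z → y * Z - y ≡ y * (Z - 1ℤ)
    pull = solve-∀
    factor : (+ x) ^ (2 ℕ.^ k ℕ.* c) - y ≡ y * ((y ^ 2) ^ r - 1ℤ ^ r)
    factor = begin
      (+ x) ^ (2 ℕ.^ k ℕ.* c) - y                 ≡⟨ cong (λ e → (+ x) ^ (2 ℕ.^ k ℕ.* e) - y) (odd⇒≡1+2* 2∤c) ⟩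
      (+ x) ^ (2 ℕ.^ k ℕ.* suc (r ℕ.* 2)) - y     ≡⟨ cong (_- y) (ℤ.^-*-assoc (+ x) (2 ℕ.^ k) (suc (r ℕ.* 2))) ⟨
      y * y ^ (r ℕ.* 2) - y                       ≡⟨ cong (λ z → y * z - y) ([x^m]^n≡x^[n*m] y 2 r) ⟨
      y * (y ^ 2) ^ r - y                         ≡⟨ pull y ((y ^ 2) ^ r) ⟩
      y * ((y ^ 2) ^ r - 1ℤ)                      ≡⟨ cong (λ z → y * ((y ^ 2) ^ r - z)) (ℤ.^-zeroˡ r) ⟨
      y * ((y ^ 2) ^ r - 1ℤ ^ r)                  ∎

  -- Necklace numbers

  necklace : ℤ → ℕ → ℤ
  necklace x = μ⋆ (x ^_)

  pos-^ : ∀ m n → + (m ℕ.^ n) ≡ (+ m) ^ n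
  pos-^ m zero    = refl
  pos-^ m (suc n) = trans (ℤ.pos-* m (m ℕ.^ n)) (cong (+ m *_) (pos-^ m n))

  necklaceSum≡necklace : ∀ q d → necklaceSum q d ≡ necklace (+ q) d
  necklaceSum≡necklace q d = trans (cong (foldr _+_ 0ℤ) (trans (map-cong term (upTo d)) (map-upTo _ d)))
                                   (foldr-applyUpTo d (μ⋆-term ((+ q) ^_) d))
    where
    term : ∀ k → (if does (suc k ∣? d) then μ (suc k) * + (q ℕ.^ (d ℕ./ suc k)) else 0ℤ) ≡ μ⋆-term ((+ q) ^_) d (suc k)
    term k = cong (λ z → if does (suc k ∣? d) then μ (suc k) * z else 0ℤ) (pos-^ q (d ℕ./ suc k))

  module _ {ℓ m : ℕ} .{{_ : NonZero m}} (pℓ : Prime ℓ) (ℓ∤m : ¬ ℓ ∣ m) (a : ℕ) (x : ℤ) where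

    necklace-split : necklace x (ℓ ℕ.^ suc a ℕ.* m) ≡ μ⋆ (λ c → x ^ (ℓ ℕ.^ suc a ℕ.* c) - x ^ (ℓ ℕ.^ a ℕ.* c)) m
    necklace-split = trans (μ⋆-split pℓ ℓ∤m a (x ^_)) (sym (μ⋆-- _ _ m))

    necklace-split′ : necklace x (ℓ ℕ.^ suc a ℕ.* m) ≡ necklace (x ^ (ℓ ℕ.^ suc a)) m - necklace (x ^ (ℓ ℕ.^ a)) m
    necklace-split′ = trans (μ⋆-split pℓ ℓ∤m a (x ^_))
      (cong₂ _-_ (μ⋆-cong m (λ c → sym (ℤ.^-*-assoc x (ℓ ℕ.^ suc a) c)))
                 (μ⋆-cong m (λ c → sym (ℤ.^-*-assoc x (ℓ ℕ.^ a) c))))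

  n∣necklace : ∀ x n .{{_ : NonZero n}} → + n ∣ℤ necklace x n
  n∣necklace x n = go n (<-wellFounded n) x
    where
    go : ∀ n .{{_ : NonZero n}} → Acc _<_ n → ∀ x → + n ∣ℤ necklace x n
    go (suc zero)      _         x = ℤ∣.∣ᵤ⇒∣ (1∣ _)
    go n@(suc (suc _)) (acc rec) x with prime-power-part n (s≤s (s≤s z≤n))
    ... | ℓ , a , m , pℓ , ℓ∤m , m≢0 , n≡ℓ^[1+a]*m =
      subst (λ k → + k ∣ℤ necklace x k) (sym n≡ℓ^[1+a]*m) (ℓ^a∣∧m∣⇒ℓ^a*m∣ pℓ ℓ∤m (suc a) ℓ-part m-part)
      where
      instance _ = m≢0
      1<ℓ^[1+a] : 1 < ℓ ℕ.^ suc a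
      1<ℓ^[1+a] = ℕ.^-monoʳ-< ℓ (ℕ.nonTrivial⇒n>1 ℓ ⦃ prime⇒nonTrivial pℓ ⦄) {0} {suc a} (s≤s z≤n)
      m<n : m < n
      m<n = subst (m <_) (trans (ℕ.*-comm m (ℓ ℕ.^ suc a)) (sym n≡ℓ^[1+a]*m)) (ℕ.m<m*n m (ℓ ℕ.^ suc a) 1<ℓ^[1+a])
      m-part : + m ∣ℤ necklace x (ℓ ℕ.^ suc a ℕ.* m)
      m-part = subst (+ m ∣ℤ_) (sym (necklace-split′ pℓ ℓ∤m a x))
                 (ℤ∣.∣m∣n⇒∣m-n (go m (rec m<n) (x ^ (ℓ ℕ.^ suc a))) (go m (rec m<n) (x ^ (ℓ ℕ.^ a))))
      ℓ-part : + (ℓ ℕ.^ suc a) ∣ℤ necklace x (ℓ ℕ.^ suc a ℕ.* m)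
      ℓ-part = subst (+ (ℓ ℕ.^ suc a) ∣ℤ_) (sym (necklace-split pℓ ℓ∤m a x)) (μ⋆-∣ {n = m} λ {c} _ →
                 subst (+ (ℓ ℕ.^ suc a) ∣ℤ_)
                   (cong₂ _-_ ([x^m]^n≡x^[n*m] x c (ℓ ℕ.^ suc a)) ([x^m]^n≡x^[n*m] x c (ℓ ℕ.^ a)))
                   (ℓ^[1+b]∣x^ℓ^[1+b]-x^ℓ^b pℓ (x ^ c) a))

  x∣x^c : ∀ x c .{{_ : NonZero c}} → x ∣ℤ x ^ c
  x∣x^c x (suc c) = ℤ∣.∣m⇒∣m*n (x ^ c) ℤ∣.∣-refl

  x∣necklace : ∀ x n .{{_ : NonZero n}} → x ∣ℤ necklace x n
  x∣necklace x n = μ⋆-∣ λ {c} c∣n → x∣x^c x c ⦃ divisor-nonZero c∣n ⦄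

  x^ℓ^a∣necklace : ∀ {ℓ m} .{{_ : NonZero m}} → Prime ℓ → ¬ ℓ ∣ m → ∀ a x →
                   x ^ (ℓ ℕ.^ a) ∣ℤ necklace x (ℓ ℕ.^ suc a ℕ.* m)
  x^ℓ^a∣necklace {ℓ} {m} pℓ ℓ∤m a x =
    subst (x ^ (ℓ ℕ.^ a) ∣ℤ_) (sym (necklace-split pℓ ℓ∤m a x)) (μ⋆-∣ {n = m} term)
    where
    term : ∀ {c} → c ∣ m → x ^ (ℓ ℕ.^ a) ∣ℤ x ^ (ℓ ℕ.^ suc a ℕ.* c) - x ^ (ℓ ℕ.^ a ℕ.* c)
    term {c} c∣m = ℤ∣.∣m∣n⇒∣m-n
      (subst (x ^ (ℓ ℕ.^ a) ∣ℤ_) (trans (ℤ.^-*-assoc x (ℓ ℕ.^ a) (ℓ ℕ.* c)) (cong (x ^_) (regroup)))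
        (x∣x^c _ (ℓ ℕ.* c) ⦃ ℕ.m*n≢0 ℓ c ⦃ prime⇒nonZero pℓ ⦄ ⦃ c≢0 ⦄ ⦄))
      (subst (x ^ (ℓ ℕ.^ a) ∣ℤ_) (ℤ.^-*-assoc x (ℓ ℕ.^ a) c) (x∣x^c _ c ⦃ c≢0 ⦄))
      where
      c≢0 = divisor-nonZero c∣m
      regroup : ℓ ℕ.^ a ℕ.* (ℓ ℕ.* c) ≡ ℓ ℕ.^ suc a ℕ.* c
      regroup = trans (x∙yz≈y∙xz (ℓ ℕ.^ a) ℓ c) (sym (ℕ.*-assoc ℓ (ℓ ℕ.^ a) c))

  2^[2+a]∣necklace : ∀ {x m} .{{_ : NonZero m}} → ¬ 2 ∣ x → ¬ 2 ∣ m → 2 ≤ m → ∀ a →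
                    + (2 ℕ.^ (2 ℕ.+ a)) ∣ℤ necklace (+ x) (2 ℕ.^ a ℕ.* m)
  2^[2+a]∣necklace {x} {m} 2∤x 2∤m 2≤m zero =
    subst (+ 4 ∣ℤ_) (sym (trans (cong (necklace (+ x)) (ℕ.*-identityˡ m)) (μ⋆-sub-const ((+ x) ^_) (+ x) m 2≤m)))
      (μ⋆-∣ λ {c} c∣m → ℤ∣.∣-trans (ℤ∣.∣ᵤ⇒∣ {+ 4} {+ 8} (divides 2 refl))
        (subst₂ (λ e y → + 8 ∣ℤ (+ x) ^ e - y) (ℕ.*-identityˡ c) (ℤ.^-identityʳ (+ x))
          (2^[3+k]∣x^[2^k*c]-x^2^k 2∤x (2∤m ∘ λ 2∣c → ∣-trans 2∣c c∣m) 0)))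
  2^[2+a]∣necklace {x} {m} 2∤x 2∤m 2≤m (suc a) =
    subst (+ (2 ℕ.^ (3 ℕ.+ a)) ∣ℤ_)
      (sym (trans (necklace-split prime[2] 2∤m a (+ x)) (μ⋆-sub-const _ (X (2 ℕ.^ suc a) - X (2 ℕ.^ a)) m 2≤m)))
      (μ⋆-∣ λ {c} c∣m → subst (+ (2 ℕ.^ (3 ℕ.+ a)) ∣ℤ_)
        (sym (regroup (X (2 ℕ.^ suc a ℕ.* c)) (X (2 ℕ.^ suc a)) (X (2 ℕ.^ a ℕ.* c)) (X (2 ℕ.^ a))))
        (ℤ∣.∣m∣n⇒∣m-n (ℤ∣.∣-trans (ℤ∣.∣ᵤ⇒∣ {+ (2 ℕ.^ (3 ℕ.+ a))} {+ (2 ℕ.^ (4 ℕ.+ a))} (n∣m*n 2))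
                                  (2^[3+k]∣x^[2^k*c]-x^2^k 2∤x (2∤m ∘ λ 2∣c → ∣-trans 2∣c c∣m) (suc a)))
                      (2^[3+k]∣x^[2^k*c]-x^2^k 2∤x (2∤m ∘ λ 2∣c → ∣-trans 2∣c c∣m) a)))
    where
    X : ℕ → ℤ
    X e = (+ x) ^ e
    regroup : ∀ A A₀ B B₀ → A - B - (A₀ - B₀) ≡ A - A₀ - (B - B₀)
    regroup = solve-∀

  -- The quotient πq q d

  [t*d]/ℕd≡t : ∀ t d .{{_ : NonZero d}} → (t * + d) /ℕ d ≡ t
  [t*d]/ℕd≡t (+ t)    d       = trans (cong (_/ℕ d) (sym (ℤ.pos-* t d))) (cong +_ (m*n/n≡m t d))
  [t*d]/ℕd≡t -[1+ t ] (suc d) rewrite m*n%n≡0 (suc t) (suc d) ⦃ _ ⦄ = cong (λ k → - (+ k)) (m*n/n≡m (suc t) (suc d))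

  πq≡quotient : ∀ q d .{{_ : NonZero d}} t → necklace (+ q) d ≡ t * + d → πq q d ≡ t
  πq≡quotient q (suc d) t N≡t*d =
    trans (cong (_/ℕ suc d) (trans (necklaceSum≡necklace q (suc d)) N≡t*d)) ([t*d]/ℕd≡t t (suc d))

  ∣t*d⇒∣∣t∣*d : ∀ {k N} t d → + k ∣ℤ N → N ≡ t * + d → k ∣ ∣ t ∣ ℕ.* d
  ∣t*d⇒∣∣t∣*d t d k∣N N≡t*d = subst (_ ∣_) (trans (cong ∣_∣ N≡t*d) (ℤ.abs-* t (+ d))) (ℤ∣.∣⇒∣ᵤ k∣N)

  p∣quotient : ∀ {p s d} .{{_ : NonZero d}} t → Prime p → 1 ≤ s → ¬ p ∣ d →
               necklace (+ (p ℕ.^ s)) d ≡ t * + d → p ∣ ∣ t ∣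
  p∣quotient {p} {suc s} {d} t pp _ p∤d N≡t*d =
    [ id , ⊥-elim ∘ p∤d ]′ (euclidsLemma ∣ t ∣ d pp (∣t*d⇒∣∣t∣*d t d p∣N N≡t*d))
    where
    p∣N : + p ∣ℤ necklace (+ (p ℕ.^ suc s)) d
    p∣N = ℤ∣.∣-trans (ℤ∣.∣ᵤ⇒∣ {+ p} {+ (p ℕ.^ suc s)} (m∣m*n (p ℕ.^ s))) (x∣necklace (+ (p ℕ.^ suc s)) d)

  2∣quotient : ∀ {s d} .{{_ : NonZero d}} t → 1 ≤ s → 2 ℕ.^ s ≢ 2 → 2 ∣ d →
               necklace (+ (2 ℕ.^ s)) d ≡ t * + d → 2 ∣ ∣ t ∣
  2∣quotient {s} {d} t 1≤s q≢2 2∣d N≡t*d with factor-out 2 d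
  ... | zero  , m , 2∤m , d≡m  = ⊥-elim (2∤m (subst (2 ∣_) (trans d≡m (ℕ.*-identityˡ m)) 2∣d))
  ... | suc a , m , 2∤m , refl =
    ℓ^[k+a]∣n*[ℓ^a*m]⇒ℓ^k∣n prime[2] 2∤m 1 (suc a) (∣t*d⇒∣∣t∣*d t _ 2^[2+a]∣N N≡t*d)
    where
    instance _ = ℕ.m*n≢0⇒n≢0 (2 ℕ.^ suc a)
    2≤s : 2 ≤ s
    2≤s = ℕ.≤∧≢⇒< 1≤s (λ 1≡s → q≢2 (cong (2 ℕ.^_) (sym 1≡s)))
    2^[2+a]∣q^2^a : + (2 ℕ.^ (2 ℕ.+ a)) ∣ℤ (+ (2 ℕ.^ s)) ^ (2 ℕ.^ a)
    2^[2+a]∣q^2^a = subst (+ (2 ℕ.^ (2 ℕ.+ a)) ∣ℤ_)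
      (trans (cong +_ (sym (ℕ.^-*-assoc 2 s (2 ℕ.^ a)))) (pos-^ (2 ℕ.^ s) (2 ℕ.^ a)))
      (ℤ∣.∣ᵤ⇒∣ (^-monoʳ-∣ 2 (ℕ.≤-trans (2+a≤2^[1+a] a) (ℕ.*-monoˡ-≤ (2 ℕ.^ a) 2≤s))))
    2^[2+a]∣N : + (2 ℕ.^ (2 ℕ.+ a)) ∣ℤ necklace (+ (2 ℕ.^ s)) (2 ℕ.^ suc a ℕ.* m)
    2^[2+a]∣N = ℤ∣.∣-trans 2^[2+a]∣q^2^a (x^ℓ^a∣necklace prime[2] 2∤m a (+ (2 ℕ.^ s)))

  4∣quotient : ∀ {p s d} .{{_ : NonZero d}} t → Prime p → p ≢ 2 → p ∣ d →
               necklace (+ (p ℕ.^ s)) d ≡ t * + d → 4 ∣ ∣ t ∣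
  4∣quotient {p} {s} {d} t pp p≢2 p∣d N≡t*d with factor-out 2 d
  ... | a , m , 2∤m , refl = ℓ^[k+a]∣n*[ℓ^a*m]⇒ℓ^k∣n prime[2] 2∤m 2 a (∣t*d⇒∣∣t∣*d t _ 2^[2+a]∣N N≡t*d)
    where
    instance _ = ℕ.m*n≢0⇒n≢0 (2 ℕ.^ a)
    2∤p : ¬ 2 ∣ p
    2∤p 2∣p = p≢2 (sym (prime∣prime⇒≡ prime[2] pp 2∣p))
    2≤m : 2 ≤ m
    2≤m = ℕ.≤-trans (ℕ.nonTrivial⇒n>1 p ⦃ prime⇒nonTrivial pp ⦄) (∣⇒≤ (∣ℓ^a*m⇒∣m prime[2] 2∤p a p∣d))
    2^[2+a]∣N : + (2 ℕ.^ (2 ℕ.+ a)) ∣ℤ necklace (+ (p ℕ.^ s)) (2 ℕ.^ a ℕ.* m)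
    2^[2+a]∣N = 2^[2+a]∣necklace (∤⇒∤^ prime[2] 2∤p s) 2∤m 2≤m a

open import Data.Nat using (ℕ; _^_; _≤_)
open import Data.Nat.Primality using (Prime)
open import Data.Integer using (+_)
open import Data.Integer.Divisibility using (_∣_)
open import Data.Sum using (_⊎_)
open import Relation.Binary.PropositionalEquality using (_≢_)
open import Data.Integer.Divisibility.Signed using (module _∣_)
open import Data.Nat using (_≟_; >-nonZero)
open import Data.Nat.Divisibility using (_∣?_)
open import Data.Sum using (inj₁; inj₂)
open import Relation.Nullary using (yes; no)
open import Relation.Binary.PropositionalEquality using (refl; subst; sym)
open Necklaces using (n∣necklace; πq≡quotient; p∣quotient; 2∣quotient; 4∣quotient)

mainTheorem15 : (p s : ℕ) → Prime p → 1 ≤ s → p ^ s ≢ 2 → (d : ℕ) → 1 ≤ d → (+ p ∣ πq (p ^ s) d) ⊎ (+ 4 ∣ πq (p ^ s) d)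
mainTheorem15 p s pp 1≤s q≢2 d 1≤d =
  subst (λ π → (+ p ∣ π) ⊎ (+ 4 ∣ π)) (sym (πq≡quotient (p ^ s) d t N≡t*d)) t-dichotomy
  where
  instance _ = >-nonZero 1≤d
  open _∣_ (n∣necklace (+ (p ^ s)) d) renaming (quotient to t; equality to N≡t*d)
  t-dichotomy : (+ p ∣ t) ⊎ (+ 4 ∣ t)
  t-dichotomy with p ∣? d | p ≟ 2
  ... | no p∤d  | _        = inj₁ (p∣quotient t pp 1≤s p∤d N≡t*d)
  ... | yes p∣d | yes refl = inj₁ (2∣quotient t 1≤s q≢2 p∣d N≡t*d)
  ... | yes p∣d | no p≢2   = inj₂ (4∣quotient {s = s} t pp p≢2 p∣d N≡t*d)
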